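{- Let $G$ be a homogeneous $m$-generic $L$-graph, and let $S_{ij}\subseteq O(G)$ be a $C_{ij}^{kl}$-omission set with code $(i,j,k,l;c_{ik},c_{il},c_{jk},c_{jl})$. Then no $A\in O(G)$ is a monic with vertices in all four parts $V_i,V_j,V_k,V_l$ whose $E_{ik},E_{il},E_{jk},E_{jl}$-edges have colours $c_{ik},c_{il},c_{jk},c_{jl}$ respectively.
   Context: A language $L$ for coloured $m$-partite graphs specifies, for each pair of distinct $i,j\in\{0,\dots,m-1\}$, a finite nonempty set of colours $C_{ij}=C_{ji}$. An $L$-graph has vertex set partitioned into parts $V_0,\dots,V_{m-1}$ (no edges inside parts) with a colour $F(x,y)=F(y,x)\in C_{ij}$ for $x\in V_i,y\in V_j$, $i\ne j$. Substructures are induced subgraphs; embeddings are injective, part- and colour-preserving. $G$ is homogeneous if every isomorphism between finite induced subgraphs extends to an automorphism. $G$ is $m$-generic if every part is countably infinite and for all distinct $i,j$, finite $U\subseteq V_i$ and $f:U\to C_{ij}$ there is $x\in V_j$ with $F(x,u)=f(u)$ for all $u\in U$. A finite $L$-graph is realized in $G$ if it embeds in $G$, otherwise omitted; minimally omitted if omitted but all proper induced subgraphs are realized; $O(G)$ is the class of finite $L$-graphs minimally omitted from $G$. A monic is a finite $L$-graph with at most one vertex in each part; an $ijk$-triangle has exactly one vertex in each of $V_i,V_j,V_k$ and none elsewhere; a monic's $E_{ij}$-edge is the edge between its vertices in $V_i$ and $V_j$. For distinct $i,j,k,l$, a $C_{ij}^{kl}$-omission set with code $(i,j,k,l;c_{ik},c_{il},c_{jk},c_{jl})$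 is a set of $ijk$-triangles and $ijl$-triangles such that every colour of $C_{ij}$ occurs on the $E_{ij}$-edge of some member, every $ijk$-triangle in it has $E_{ik},E_{jk}$-edges coloured $c_{ik},c_{jk}$, and every $ijl$-triangle in it has $E_{il},E_{jl}$-edges coloured $c_{il},c_{jl}$. -}

module Defs where

open import Data.Nat using (ℕ; _<_)
open import Data.Fin using (Fin)
open import Data.Product using (Σ; ∃; _×_; _,_; proj₁; proj₂)
open import Data.Sum using (_⊎_)
open import Relation.Nullary using (¬_)
open import Relation.Binary.PropositionalEquality using (_≡_; _≢_)
open import Function.Definitions using (Injective)
open import Function.Bundles using (_⤖_; Bijection)

-- Languages for coloured m-partite graphs.
-- The colour set C_ij is {0, …, col i j - 1} (finite and nonempty for
-- i ≢ j), with C_ij = C_ji.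

record Language : Set where
  field
    m       : ℕ
    col     : Fin m → Fin m → ℕ
    col-sym : ∀ i j → col i j ≡ col j i
    col-pos : ∀ i j → i ≢ j → 0 < col i j

module _ (L : Language) where
  open Language L

  -- An L-graph structure on a vertex type V: a part function and an edge
  -- colouring F (only meaningful between different parts; values between
  -- vertices of the same part are irrelevant: there are no such edges).
  record Structure (V : Set) : Set where
    field
      part  : V → Fin m
      F     : V → V → ℕ
      F-sym : ∀ x y → F x y ≡ F y x
      F-col : ∀ x y → part x ≢ part y → F x y < col (part x) (part y)

  record LGraph : Set₁ where
    field
      V   : Set
      str : Structure V
    open Structure str public

  record FinLGraph : Set where
    field
      n   : ℕ
      str : Structure (Fin n)
    open Structure str public

  open Structure

  Preserves : {U W : Set} → Structure U → Structure W → (U → W) → Set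
  Preserves A B f =
    (∀ x → part B (f x) ≡ part A x) ×
    (∀ x y → part A x ≢ part A y → F B (f x) (f y) ≡ F A x y)

  IsEmbedding : {U W : Set} → Structure U → Structure W → (U → W) → Set
  IsEmbedding A B f = Injective _≡_ _≡_ f × Preserves A B f

  -- Induced substructure of a finite L-graph on the image of an injective
  -- h : Fin k → Fin n (the substructure re-indexed by Fin k).
  restrict : ∀ {n k} → Structure (Fin n) → (Fin k → Fin n) → Structure (Fin k)
  restrict A h = record
    { part  = λ x → part A (h x)
    ; F     = λ x y → F A (h x) (h y)
    ; F-sym = λ x y → F-sym A (h x) (h y)
    ; F-col = λ x y p → F-col A (h x) (h y) p
    }

  module _ (G : LGraph) where
    private
      module G = LGraph G

    IsAutomorphism : (G.V ⤖ G.V) → Set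
    IsAutomorphism σ = Preserves G.str G.str (Bijection.to σ)

    -- Homogeneous: every isomorphism between finite induced subgraphs
    -- (enumerated by injective a b : Fin n → V, the isomorphism being
    -- a k ↦ b k) extends to an automorphism.
    Homogeneous : Set
    Homogeneous =
      ∀ (n : ℕ) (a b : Fin n → G.V) →
      Injective _≡_ _≡_ a → Injective _≡_ _≡_ b →
      (∀ x → G.part (a x) ≡ G.part (b x)) →
      (∀ x y → G.part (a x) ≢ G.part (a y) → G.F (a x) (a y) ≡ G.F (b x) (b y)) →
      Σ (G.V ⤖ G.V) λ σ → IsAutomorphism σ × (∀ x → Bijection.to σ (a x) ≡ b x)

    CountablyInfinitePart : Fin m → Set
    CountablyInfinitePart i =
      Σ (ℕ → G.V) λ e →
        Injective _≡_ _≡_ e × (∀ t → G.part (e t) ≡ i) ×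
        (∀ v → G.part v ≡ i → ∃ λ t → e t ≡ v)

    Generic : Set
    Generic =
      (∀ i → CountablyInfinitePart i) ×
      (∀ (i j : Fin m) → i ≢ j →
        ∀ (n : ℕ) (u : Fin n → G.V) → Injective _≡_ _≡_ u →
        (∀ t → G.part (u t) ≡ i) →
        (f : Fin n → ℕ) → (∀ t → f t < col i j) →
        ∃ λ x → G.part x ≡ j × (∀ t → G.F x (u t) ≡ f t))

    Realized : FinLGraph → Set
    Realized A = ∃ λ (f : Fin (FinLGraph.n A) → G.V) →
      IsEmbedding (FinLGraph.str A) G.str f

    Omitted : FinLGraph → Set
    Omitted A = ¬ Realized A

    MinimallyOmitted : FinLGraph → Set
    MinimallyOmitted A =
      Omitted A ×
      (∀ (k : ℕ) (h : Fin k → Fin (FinLGraph.n A)) →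
        k < FinLGraph.n A → Injective _≡_ _≡_ h →
        Realized (record { n = k ; str = restrict (FinLGraph.str A) h }))

    InO : FinLGraph → Set
    InO = MinimallyOmitted

  module _ (A : FinLGraph) where
    private
      module A = FinLGraph A

    Monic : Set
    Monic = Injective _≡_ _≡_ A.part

    HasVertexIn : Fin m → Set
    HasVertexIn i = ∃ λ x → A.part x ≡ i

    Triangle : Fin m → Fin m → Fin m → Set
    Triangle i j k =
      Monic × HasVertexIn i × HasVertexIn j × HasVertexIn k ×
      (∀ x → A.part x ≡ i ⊎ A.part x ≡ j ⊎ A.part x ≡ k)

    -- For a monic: its E_ij-edge has colour c.
    EdgeColour : Fin m → Fin m → ℕ → Set
    EdgeColour i j c = ∃ λ x → ∃ λ y → A.part x ≡ i × A.part y ≡ j × A.F x y ≡ c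

  OmissionSet : (FinLGraph → Set) → (i j k l : Fin m) → (cik cil cjk cjl : ℕ) → Set
  OmissionSet S i j k l cik cil cjk cjl =
    (∀ A → S A → Triangle A i j k ⊎ Triangle A i j l) ×
    (∀ c → c < col i j → ∃ λ A → S A × EdgeColour A i j c) ×
    (∀ A → S A → Triangle A i j k → EdgeColour A i k cik × EdgeColour A j k cjk) ×
    (∀ A → S A → Triangle A i j l → EdgeColour A i l cil × EdgeColour A j l cjl)

  Distinct4 : (i j k l : Fin m) → Set
  Distinct4 i j k l = i ≢ j × i ≢ k × i ≢ l × j ≢ k × j ≢ l × k ≢ l

-- Let A ∈ O(G) be such a monic and c the colour of its E_ij-edge. Some triangle T ∈ S has
-- E_ij-colour c; say T is an ijk-triangle. Its other two edges have the colours c_ik, c_jk of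
-- the code, which are also the colours of those edges in A, so T embeds into A on A's vertices
-- in V_i, V_j, V_k. This image misses A's vertex in V_l, so it is a proper induced subgraph of
-- the minimally omitted A and hence realized in G; thus T is realized, contradicting T ∈ O(G).
module Submission where

open import Defs
open import Data.Nat using (ℕ; _<_)
import Data.Nat as ℕ
open import Data.Fin using (Fin; zero; suc)
open import Data.Fin.Properties using (injective⇒≤)
open import Data.Product using (∃; _×_; _,_; proj₁; proj₂)
open import Data.Sum using (_⊎_; inj₁; inj₂)
open import Data.Empty using (⊥-elim)
open import Function using (_∘_)
open import Function.Definitions using (Injective)
open import Relation.Nullary using (¬_)
open import Relation.Binary.PropositionalEquality
  using (_≡_; _≢_; refl; sym; trans; cong)

injective-avoiding⇒< : ∀ {a b} (f : Fin a → Fin b) → Injective _≡_ _≡_ f →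
  (v : Fin b) → (∀ x → f x ≢ v) → a < b
injective-avoiding⇒< {a} {b} f f-inj v v∉f = injective⇒≤ extend-injective
  where
  extend : Fin (ℕ.suc a) → Fin b
  extend zero    = v
  extend (suc x) = f x

  extend-injective : Injective _≡_ _≡_ extend
  extend-injective {zero}  {zero}  _  = refl
  extend-injective {zero}  {suc y} eq = ⊥-elim (v∉f y (sym eq))
  extend-injective {suc x} {zero}  eq = ⊥-elim (v∉f x eq)
  extend-injective {suc x} {suc y} eq = cong suc (f-inj eq)

module _ {L : Language} where
  open Language L

  module _ (A : FinLGraph L) where
    private
      module A = FinLGraph A

    EdgeColour-sym : ∀ {p q c} → EdgeColour L A p q c → EdgeColour L A q p c
    EdgeColour-sym (x , y , px , qy , Fxy) = y , x , qy , px , trans (A.F-sym y x) Fxy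

    edge-hasColour : ∀ {p q} → HasVertexIn L A p → HasVertexIn L A q → p ≢ q →
      ∃ λ c → c < col p q × EdgeColour L A p q c
    edge-hasColour (x , refl) (y , refl) p≢q =
      A.F x y , A.F-col x y p≢q , x , y , refl , refl , refl

    monic-F≡ : Monic L A → ∀ {p q c} → EdgeColour L A p q c →
      ∀ {x y} → A.part x ≡ p → A.part y ≡ q → A.F x y ≡ c
    monic-F≡ mon (x′ , y′ , px′ , qy′ , Fx′y′≡c) px qy
      with mon (trans px (sym px′)) | mon (trans qy (sym qy′))
    ... | refl | refl = Fx′y′≡c

  EdgeAgree : FinLGraph L → FinLGraph L → Fin m → Fin m → Set
  EdgeAgree A T p q = ∃ λ c → EdgeColour L A p q c × EdgeColour L T p q c

  EdgeAgree-sym : ∀ A T {p q} → EdgeAgree A T p q → EdgeAgree A T q p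
  EdgeAgree-sym A T (c , Apq , Tpq) = c , EdgeColour-sym A Apq , EdgeColour-sym T Tpq

  module _ (A T : FinLGraph L) where
    private
      module A = FinLGraph A
      module T = FinLGraph T

    monic-embedding : Monic L A → Monic L T →
      (a : ∀ x → HasVertexIn L A (T.part x)) →
      (∀ x y → T.part x ≢ T.part y → EdgeAgree A T (T.part x) (T.part y)) →
      IsEmbedding L T.str A.str (proj₁ ∘ a)
    monic-embedding monA monT a agree = injective , (proj₂ ∘ a) , colours
      where
      injective : Injective _≡_ _≡_ (proj₁ ∘ a)
      injective {x} {y} ax≡ay =
        monT (trans (sym (proj₂ (a x))) (trans (cong A.part ax≡ay) (proj₂ (a y))))

      colours : ∀ x y → T.part x ≢ T.part y → A.F (proj₁ (a x)) (proj₁ (a y)) ≡ T.F x y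
      colours x y px≢py with agree x y px≢py
      ... | c , Axy , Txy =
        trans (monic-F≡ A monA Axy (proj₂ (a x)) (proj₂ (a y))) (sym (monic-F≡ T monT Txy refl refl))

    triangle-edgeAgree : ∀ {i j r} → Triangle L T i j r →
      EdgeAgree A T i j → EdgeAgree A T i r → EdgeAgree A T j r →
      ∀ x y → T.part x ≢ T.part y → EdgeAgree A T (T.part x) (T.part y)
    triangle-edgeAgree {i} {j} {r} (_ , _ , _ , _ , cover) ij ir jr x y = pick (cover x) (cover y)
      where
      pick : ∀ {p q} → p ≡ i ⊎ p ≡ j ⊎ p ≡ r → q ≡ i ⊎ q ≡ j ⊎ q ≡ r → p ≢ q → EdgeAgree A T p q
      pick (inj₁ refl)        (inj₁ refl)        p≢q = ⊥-elim (p≢q refl)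
      pick (inj₁ refl)        (inj₂ (inj₁ refl)) _   = ij
      pick (inj₁ refl)        (inj₂ (inj₂ refl)) _   = ir
      pick (inj₂ (inj₁ refl)) (inj₁ refl)        _   = EdgeAgree-sym A T ij
      pick (inj₂ (inj₁ refl)) (inj₂ (inj₁ refl)) p≢q = ⊥-elim (p≢q refl)
      pick (inj₂ (inj₁ refl)) (inj₂ (inj₂ refl)) _   = jr
      pick (inj₂ (inj₂ refl)) (inj₁ refl)        _   = EdgeAgree-sym A T ir
      pick (inj₂ (inj₂ refl)) (inj₂ (inj₁ refl)) _   = EdgeAgree-sym A T jr
      pick (inj₂ (inj₂ refl)) (inj₂ (inj₂ refl)) p≢q = ⊥-elim (p≢q refl)

  module _ (G : LGraph L) (A T : FinLGraph L) where
    private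
      module A = FinLGraph A
      module T = FinLGraph T

    -- The restriction of A along an embedding e of T is T itself, up to the re-indexing e.
    minimallyOmitted-properEmbedding⇒realized : MinimallyOmitted L G A →
      (e : Fin T.n → Fin A.n) → IsEmbedding L T.str A.str e → T.n < A.n → Realized L G T
    minimallyOmitted-properEmbedding⇒realized (_ , proper) e (e-inj , e-part , e-F) Tn<An
      with proper T.n e Tn<An e-inj
    ... | g , g-inj , g-part , g-F = g , g-inj , (λ x → trans (g-part x) (e-part x)) , g-F′
      where
      g-F′ : ∀ x y → T.part x ≢ T.part y → LGraph.F G (g x) (g y) ≡ T.F x y
      g-F′ x y px≢py = trans (g-F x y (px≢py ∘ λ eq → trans (sym (e-part x)) (trans eq (e-part y))))
                             (e-F x y px≢py)

    triangle-realized : ∀ {i j r s} → MinimallyOmitted L G A → Monic L A →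
      HasVertexIn L A i → HasVertexIn L A j → HasVertexIn L A r → HasVertexIn L A s →
      s ≢ i → s ≢ j → s ≢ r → Triangle L T i j r →
      EdgeAgree A T i j → EdgeAgree A T i r → EdgeAgree A T j r → Realized L G T
    triangle-realized {s = s} omA monA hi hj hr (v , v∈s) s≢i s≢j s≢r
      triT@(monT , _ , _ , _ , cover) ij ir jr =
      minimallyOmitted-properEmbedding⇒realized omA (proj₁ ∘ a) embedding
        (injective-avoiding⇒< (proj₁ ∘ a) (proj₁ embedding) v misses-v)
      where
      a : ∀ x → HasVertexIn L A (T.part x)
      a x with T.part x | cover x
      ... | _ | inj₁ refl        = hi
      ... | _ | inj₂ (inj₁ refl) = hj
      ... | _ | inj₂ (inj₂ refl) = hr

      embedding : IsEmbedding L T.str A.str (proj₁ ∘ a)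
      embedding = monic-embedding A T monA monT a (triangle-edgeAgree A T triT ij ir jr)

      part≢s : ∀ x → T.part x ≢ s
      part≢s x px≡s with cover x
      ... | inj₁ px≡i        = s≢i (trans (sym px≡s) px≡i)
      ... | inj₂ (inj₁ px≡j) = s≢j (trans (sym px≡s) px≡j)
      ... | inj₂ (inj₂ px≡r) = s≢r (trans (sym px≡s) px≡r)

      misses-v : ∀ x → proj₁ (a x) ≢ v
      misses-v x ax≡v = part≢s x (trans (sym (proj₂ (a x))) (trans (cong A.part ax≡v) v∈s))

lemma6p3 : (L : Language) (G : LGraph L) →
    Homogeneous L G → Generic L G →
    (S : FinLGraph L → Set) →
    (i j k l : Fin (Language.m L)) → Distinct4 L i j k l →
    (cik cil cjk cjl : ℕ) →
    (∀ A → S A → InO L G A) →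
    OmissionSet L S i j k l cik cil cjk cjl →
    ¬ (∃ λ A → InO L G A × Monic L A ×
        HasVertexIn L A i × HasVertexIn L A j × HasVertexIn L A k × HasVertexIn L A l ×
        EdgeColour L A i k cik × EdgeColour L A i l cil ×
        EdgeColour L A j k cjk × EdgeColour L A j l cjl)
lemma6p3 L G _ _ S i j k l (i≢j , i≢k , i≢l , j≢k , j≢l , k≢l) cik cil cjk cjl S⊆O
  (triangles , allColours , colours-k , colours-l)
  (A , omA , monA , hi , hj , hk , hl , Aik , Ail , Ajk , Ajl)
  with edge-hasColour A hi hj i≢j
... | c , c<col , Aij with allColours c c<col
... | T , T∈S , Tij with triangles T T∈S | proj₁ (S⊆O T T∈S)
... | inj₁ triK | T-omitted =
  let (Tik , Tjk) = colours-k T T∈S triK in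
  T-omitted (triangle-realized G A T omA monA hi hj hk hl (i≢l ∘ sym) (j≢l ∘ sym) (k≢l ∘ sym) triK
    (c , Aij , Tij) (cik , Aik , Tik) (cjk , Ajk , Tjk))
... | inj₂ triL | T-omitted =
  let (Til , Tjl) = colours-l T T∈S triL in
  T-omitted (triangle-realized G A T omA monA hi hj hl hk (i≢k ∘ sym) (j≢k ∘ sym) k≢l triL
    (c , Aij , Tij) (cil , Ail , Til) (cjl , Ajl , Tjl))
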